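{- Let $\eta\ge\delta$ and $\zeta\ge\max(\eta,\alpha)+\delta$ be integers, let $G$ satisfy conditions (i)–(v), and let $\mathcal{T}$ be a 1-cleaned $(\zeta,\eta)$-template array in $G$ with sequence $(Y_i,H_i)$, $1\le i\le n$. Then for each $v\in V(\mathcal{T})$ there are fewer than $\gamma$ values of $i\in\{1,\dots,n\}$ such that $v$ has a neighbour in $H_i$, where $\gamma=(2\delta\tau+1)(2\delta+1)$.
   Context: Fixed parameters: integers $\tau\ge0$, $\alpha\ge1$, $\delta\ge1$, $\beta\ge2$ and a non-decreasing $\theta:\mathbb{N}\to\mathbb{N}$. Graphs are finite and simple; $\chi(X)=\chi(G[X])$. A $(k,\delta)$-broom is obtained from a $k$-edge path with ends $a,b$ by adding $\delta$ leaves adjacent to $b$ ($a$ is the handle); $T(\delta)$ is obtained from $\delta$ disjoint $(1,\delta)$-brooms and $\delta$ disjoint $(2,\delta)$-brooms by identifying their handles; $H$-free means no induced subgraph isomorphic to $H$. $\chi^2(G)=\max_v\chi(N^2[v])$, $N^2[v]$ the vertices at distance $\le2$ from $v$. $X\subseteq V(G)$ is matching-covered if each $x\in X$ has a neighbour $y\notin X$ adjacent to no other vertex of $X$. An $(a,b)$-core is a set of $ab$ vertices partitioned into $b$ stable sets (parts) of size $a$ with all edges between distinct parts. Conditions: (i) $G$ is $T(\delta)$-free; (ii) $\chi^2(G)\le\tau$; (iii) every matching-covered set has chromatic number $\le\tau$; (iv) for all $a\ge1$, if $\chi(G)>\theta(a)$ then $G$ has an $(a,\beta)$-core; (v) $G$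 has no $(\alpha,\beta+1)$-core. Templates: let $Y$ be a $(\zeta,\beta)$-core. $v\in V(G)\setminus Y$ is dense to $Y$ if it has at least $\alpha$ neighbours in each part of $Y$. $v$ is $\eta$-mixed on $Y$ if $v$ is not dense to $Y$ and has at least $\eta$ neighbours in some part of $Y$. A $(\zeta,\eta)$-template is $(Y,H)$ with $Y\subseteq H\subseteq V(G)$ and every vertex of $H$ $\eta$-mixed on $Y$. A $(\zeta,\eta)$-template sequence is $(Y_i,H_i)$, $1\le i\le n$, of templates with, for $i<j$: $H_i\cap H_j=\emptyset$, no edge between $H_i$ and $Y_j$, no vertex of $H_j$ $\eta$-mixed on $Y_i$. A $(\zeta,\eta)$-template array $\mathcal{T}$ is such a sequence plus $U(\mathcal{T})\subseteq V(G)$ whose vertices lie in no $H_i$, are $\eta$-mixed on no $Y_i$, and have a neighbour in $\bigcup_iH_i$. $H(\mathcal{T})=\bigcup_iH_i$, $V(\mathcal{T})=H(\mathcal{T})\cup U(\mathcal{T})$. $\mathcal{T}$ is 1-cleaned if for each $i$ no vertex of $V(\mathcal{T})$ is dense to $Y_i$. -}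

module Defs where

open import Data.Nat using (ℕ; zero; suc; _+_; _*_; _≤_; _⊔_)
open import Data.Fin using (Fin) renaming (_<_ to _<ᶠ_)
open import Data.Fin.Subset using (Subset; _∈_; _∉_)
open import Data.Product using (Σ; ∃; ∃-syntax; _×_; _,_)
open import Data.Sum using (_⊎_)
open import Data.Empty using (⊥)
open import Relation.Nullary using (¬_)
open import Relation.Binary using (Decidable)
open import Relation.Binary.PropositionalEquality using (_≡_; _≢_)
open import Function.Definitions using (Injective)

record Graph : Set₁ where
  field
    N       : ℕ
    _∼_     : Fin N → Fin N → Set
    ∼-dec   : Decidable _∼_
    ∼-sym   : ∀ {u v} → u ∼ v → v ∼ u
    ∼-irr   : ∀ {u} → ¬ (u ∼ u)

open Graph public

VSet : Graph → Set₁
VSet G = Fin (N G) → Set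

Colourable : (G : Graph) → VSet G → ℕ → Set
Colourable G X k = Σ (Fin (N G) → Fin k) λ c →
  ∀ x y → X x → X y → _∼_ G x y → c x ≢ c y

AllV : (G : Graph) → VSet G
AllV G _ = Data.Unit.⊤ where import Data.Unit

record InducedCopy (G : Graph) (V : Set) (E : V → V → Set) : Set where
  field
    f     : V → Fin (N G)
    f-inj : Injective _≡_ _≡_ f
    pres  : ∀ u v → E u v → _∼_ G (f u) (f v)
    refl' : ∀ u v → _∼_ G (f u) (f v) → E u v

-- The tree T(δ): a hub (the common handle); for each i < δ a (1,δ)-broom
-- hub – b1 i with leaves l1 i j, and a (2,δ)-broom hub – m2 i – b2 i with
-- leaves l2 i j.
data TV (δ : ℕ) : Set where
  hub : TV δ
  b1  : Fin δ → TV δ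
  l1  : Fin δ → Fin δ → TV δ
  m2  : Fin δ → TV δ
  b2  : Fin δ → TV δ
  l2  : Fin δ → Fin δ → TV δ

data TEdge (δ : ℕ) : TV δ → TV δ → Set where
  e-hub-b1 : ∀ i   → TEdge δ hub (b1 i)
  e-b1-l1  : ∀ i j → TEdge δ (b1 i) (l1 i j)
  e-hub-m2 : ∀ i   → TEdge δ hub (m2 i)
  e-m2-b2  : ∀ i   → TEdge δ (m2 i) (b2 i)
  e-b2-l2  : ∀ i j → TEdge δ (b2 i) (l2 i j)

TAdj : (δ : ℕ) → TV δ → TV δ → Set
TAdj δ u v = TEdge δ u v ⊎ TEdge δ v u

TFree : ℕ → Graph → Set
TFree δ G = ¬ InducedCopy G (TV δ) (TAdj δ)

N² : (G : Graph) → Fin (N G) → VSet G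
N² G v u = u ≡ v ⊎ _∼_ G v u ⊎ ∃[ w ] (_∼_ G v w × _∼_ G w u)

χ²≤ : Graph → ℕ → Set
χ²≤ G τ = ∀ v → Colourable G (N² G v) τ

MatchingCovered : (G : Graph) → VSet G → Set
MatchingCovered G X = ∀ x → X x →
  ∃[ y ] (¬ X y × _∼_ G x y × (∀ x' → X x' → _∼_ G x' y → x' ≡ x))

record Core (G : Graph) (a b : ℕ) : Set where
  field
    y       : Fin b → Fin a → Fin (N G)
    y-inj   : ∀ p j p' j' → y p j ≡ y p' j' → (p ≡ p' × j ≡ j')
    stable  : ∀ p j j' → ¬ _∼_ G (y p j) (y p j')
    complete : ∀ p p' j j' → p ≢ p' → _∼_ G (y p j) (y p' j')

open Core public

InCore : ∀ {G a b} → Core G a b → VSet G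
InCore {G} {a} {b} Y v = ∃[ p ] ∃[ j ] (y Y p j ≡ v)

≥NbrsInPart : ∀ {G a b} → ℕ → Fin (N G) → Core G a b → Fin b → Set
≥NbrsInPart {G} {a} m v Y p =
  Σ (Fin m → Fin a) λ g → Injective _≡_ _≡_ g × (∀ k → _∼_ G v (y Y p (g k)))

module Templates (G : Graph) (α : ℕ) where

  Dense : ∀ {a b} → Fin (N G) → Core G a b → Set
  Dense v Y = ¬ InCore Y v × (∀ p → ≥NbrsInPart α v Y p)

  Mixed : ∀ {a b} → ℕ → Fin (N G) → Core G a b → Set
  Mixed η v Y = ¬ Dense v Y × ∃[ p ] ≥NbrsInPart η v Y p

  record TemplateArray (ζ η β : ℕ) : Set₁ where
    field
      n     : ℕ
      Y     : Fin n → Core G ζ β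
      H     : Fin n → VSet G
      U     : VSet G
      Y⊆H   : ∀ i v → InCore (Y i) v → H i v
      H-mix : ∀ i v → H i v → Mixed η v (Y i)
      disj      : ∀ i j → i <ᶠ j → ∀ v → H i v → ¬ H j v
      noEdge    : ∀ i j → i <ᶠ j → ∀ u v → H i u → InCore (Y j) v → ¬ _∼_ G u v
      noMixBack : ∀ i j → i <ᶠ j → ∀ v → H j v → ¬ Mixed η v (Y i)
      U-notH   : ∀ u → U u → ∀ i → ¬ H i u
      U-notMix : ∀ u → U u → ∀ i → ¬ Mixed η u (Y i)
      U-nbr    : ∀ u → U u → ∃[ i ] ∃[ w ] (H i w × _∼_ G u w)

    HT : VSet G
    HT v = ∃[ i ] H i v

    VT : VSet G
    VT v = HT v ⊎ U v

    OneCleaned : Set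
    OneCleaned = ∀ i v → VT v → ¬ Dense v (Y i)

record Conditions (τ α δ β : ℕ) (θ : ℕ → ℕ) (G : Graph) : Set₁ where
  field
    c-i   : TFree δ G
    c-ii  : χ²≤ G τ
    c-iii : ∀ X → MatchingCovered G X → Colourable G X τ
    c-iv  : ∀ a → 1 ≤ a → ¬ Colourable G (AllV G) (θ a) → Core G a β
    c-v   : ¬ Core G α (suc β)

γ : ℕ → ℕ → ℕ
γ δ τ = (2 * δ * τ + 1) * (2 * δ + 1)

module Submission where

-- Suppose v ∈ V(𝒯) has neighbours w_k ∈ H_{i_k} for γ distinct indices i_k. At most one H_i contains v,
-- and on every other core Y_i the vertex v is outside Y_i and, if it has a neighbour there, not η-mixed
-- (by the sequence conditions and 1-cleanness), so it has fewer than η neighbours in each part.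
-- A vertex u adjacent to 2δ disjoint, pairwise anticomplete cores on which it is sparse in this sense
-- is the centre of an induced T(δ): a neighbour of u in one part of a core, together with δ
-- non-neighbours in another part, gives a (1,δ)-broom, and a (2,δ)-broom is found just as easily.
-- Hence v touches fewer than 2δ of the cores. A χ²-colouring of N²[v] gives (2δ)² + 1 of the
-- remaining w_k the same colour, so they are pairwise non-adjacent. Repeatedly keeping the one with the
-- largest index (which, for the same reason, touches fewer than 2δ of the earlier cores) produces 2δ
-- witnesses none of whose w_k sees another one or its core; the brooms v – w_k – Y_{i_k} then form
-- T(δ) again. Only conditions (i) and (ii) are needed.

open import Defs
open import Data.Nat using (ℕ; zero; suc; _+_; _*_; _≤_; _<_; _⊔_; z≤n; s≤s; _≤?_)
open import Data.Nat.Properties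
  using ( ≤-trans; ≤-refl; ≤-reflexive; ≤-pred; ≰⇒>; ≤∧≢⇒<; n≤1+n; m≤m+n; m≤n+m; m≤m⊔n; m≤n⊔m
        ; +-suc; +-monoˡ-≤; +-cancelˡ-≤; _≟_; module ≤-Reasoning )
open import Data.Nat.Tactic.RingSolver using (solve-∀)
open import Data.Fin using (Fin; zero; suc; toℕ; inject≤; fromℕ<; join; splitAt) renaming (_<_ to _<ᶠ_)
open import Data.Fin.Properties as Finₚ
  using (inject≤-injective; splitAt-join; toℕ-injective; toℕ<n; any?; <-cmp) renaming (_≟_ to _≟ᶠ_)
open import Data.List using (List; []; _∷_; length; filter; map; lookup; tabulate)
open import Data.List.Properties using (length-map; length-tabulate)
open import Data.List.Extrema.Nat using (argmax; argmax-all; f[⊥]≤f[argmax]; f[xs]≤f[argmax])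
open import Data.List.Membership.Propositional.Properties using (∈-lookup)
open import Data.List.Relation.Unary.All as All using (All; []; _∷_)
import Data.List.Relation.Unary.All.Properties as Allₚ
open import Data.List.Relation.Unary.AllPairs as AllPairs using (AllPairs; []; _∷_)
import Data.List.Relation.Unary.AllPairs.Properties as AllPairsₚ
open import Data.Maybe using (just; nothing)
open import Data.Maybe.Properties using (just-injective) renaming (≡-dec to ≡-decᴹ)
open import Data.Product using (Σ; ∃; ∃-syntax; _×_; _,_; proj₁; proj₂)
open import Data.Sum using (_⊎_; inj₁; inj₂; swap)
open import Data.Sum.Properties using () renaming (≡-dec to ≡-dec⊎)
open import Data.Unit using (tt)
open import Data.Empty using (⊥-elim)
open import Function using (_∘_; _on_; id)
open import Function.Definitions using (Injective)
open import Level using (0ℓ)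
open import Relation.Nullary using (¬_; Dec; yes; no)
open import Relation.Nullary.Decidable using (decidable-stable)
open import Relation.Unary using (Pred; Decidable; _∩_; ∁; _⊆_; U)
open import Relation.Unary.Properties using (∁?)
open import Relation.Binary using (Rel; Symmetric; tri<; tri≈; tri>)
open import Relation.Binary.PropositionalEquality
  using (_≡_; _≢_; refl; sym; trans; cong; subst; module ≡-Reasoning)

-- Cliques: lists of pairwise related elements

length-filter-∁ : ∀ {A : Set} {P : Pred A 0ℓ} (P? : Decidable P) (xs : List A) →
                  length (filter P? xs) + length (filter (∁? P?) xs) ≡ length xs
length-filter-∁ P? [] = refl
length-filter-∁ P? (x ∷ xs) with P? x
... | yes _ = cong suc (length-filter-∁ P? xs)
... | no _ = trans (+-suc _ _) (cong suc (length-filter-∁ P? xs))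

allPairs-lookup : ∀ {A : Set} {R : Rel A 0ℓ} → Symmetric R → ∀ {xs} → AllPairs R xs →
                  ∀ {i j} → i ≢ j → R (lookup xs i) (lookup xs j)
allPairs-lookup R-sym (r ∷ rs) {zero} {zero} i≢j = ⊥-elim (i≢j refl)
allPairs-lookup R-sym (r ∷ rs) {zero} {suc j} _ = All.lookup r (∈-lookup j)
allPairs-lookup R-sym (r ∷ rs) {suc i} {zero} _ = R-sym (All.lookup r (∈-lookup i))
allPairs-lookup R-sym (r ∷ rs) {suc i} {suc j} i≢j = allPairs-lookup R-sym rs (i≢j ∘ cong suc)

record Clique {A : Set} (R : Rel A 0ℓ) (P : Pred A 0ℓ) (m : ℕ) : Set where
  field
    members  : List A
    pairwise : AllPairs R members
    all      : All P members
    size     : m ≤ length members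

module _ {A : Set} {R : Rel A 0ℓ} where

  open Clique

  shrink : ∀ {P m m′} → m ≤ m′ → Clique R P m′ → Clique R P m
  shrink m≤m′ K = record
    { members = members K ; pairwise = pairwise K ; all = all K ; size = ≤-trans m≤m′ (size K) }

  weaken : ∀ {P Q m} → P ⊆ Q → Clique R P m → Clique R Q m
  weaken P⊆Q K = record
    { members = members K ; pairwise = pairwise K ; all = All.map P⊆Q (all K) ; size = size K }

  image : ∀ {B : Set} {R′ : Rel B 0ℓ} {P : Pred A 0ℓ} {P′ : Pred B 0ℓ} {m} (f : A → B) →
          (∀ {a b} → R a b → R′ (f a) (f b)) → (∀ {a} → P a → P′ (f a)) →
          Clique R P m → Clique R′ P′ m
  image f Rf Pf K = record
    { members  = map f (members K)
    ; pairwise = AllPairsₚ.map⁺ (AllPairs.map Rf (pairwise K))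
    ; all      = Allₚ.map⁺ (All.map Pf (all K))
    ; size     = ≤-trans (size K) (≤-reflexive (sym (length-map f (members K))))
    }

  cons : ∀ {P m} {a} → P a → Clique R (λ b → P b × R a b) m → Clique R P (suc m)
  cons Pa K = record
    { members  = _ ∷ members K
    ; pairwise = All.map proj₂ (all K) ∷ pairwise K
    ; all      = Pa ∷ All.map proj₁ (all K)
    ; size     = s≤s (size K)
    }

  restrict : ∀ {P S m} (S? : Decidable S) (K : Clique R P m) →
             Clique R (P ∩ S) (length (filter S? (members K)))
  restrict S? K = record
    { members  = filter S? (members K)
    ; pairwise = AllPairsₚ.filter⁺ S? (pairwise K)
    ; all      = All.zip (Allₚ.filter⁺ S? (all K) , Allₚ.all-filter S? (members K))
    ; size     = ≤-refl
    }

  split : ∀ {P Q} (Q? : Decidable Q) {k n} → Clique R P (k + n) →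
          Clique R (P ∩ Q) (suc k) ⊎ Clique R (P ∩ ∁ Q) n
  split Q? {k} {n} K with suc k ≤? length (filter Q? (members K))
  ... | yes many = inj₁ (shrink many (restrict Q? K))
  ... | no few = inj₂ (shrink (+-cancelˡ-≤ k n _ (begin
      k + n                     ≤⟨ size K ⟩
      length (members K)        ≡⟨ sym (length-filter-∁ Q? (members K)) ⟩
      #Q + #∁Q                  ≤⟨ +-monoˡ-≤ #∁Q (≤-pred (≰⇒> few)) ⟩
      k + #∁Q                   ∎)) (restrict (∁? Q?) K))
    where
    open ≤-Reasoning
    #Q #∁Q : ℕ
    #Q  = length (filter Q? (members K))
    #∁Q = length (filter (∁? Q?) (members K))

  inhabited : ∀ {P m} → Clique R P (suc m) → ∃ P
  inhabited record { members = a ∷ _ ; all = Pa ∷ _ } = a , Pa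

  no-pair : ∀ {P} → (∀ {a b} → P a → P b → ¬ R a b) → ¬ Clique R P 2
  no-pair unrelated record { members = _ ∷ _ ∷ _ ; pairwise = (Rab ∷ _) ∷ _ ; all = Pa ∷ Pb ∷ _ } =
    unrelated Pa Pb Rab
  no-pair _ record { members = _ ∷ [] ; size = s≤s () }

  pick : Symmetric R → ∀ {P m} → Clique R P m →
         Σ (Fin m → A) λ g → (∀ {i j} → i ≢ j → R (g i) (g j)) × (∀ i → P (g i))
  pick R-sym K =
      (λ i → lookup (members K) (position i))
    , (λ i≢j → allPairs-lookup R-sym (pairwise K) (i≢j ∘ inject≤-injective _ _ _ _))
    , (λ i → All.lookup (all K) (∈-lookup (position i)))
    where
    position : Fin _ → Fin (length (members K))
    position i = inject≤ i (size K)

  pigeonhole : ∀ {P} (colour : A → ℕ) {t m} → (∀ {a} → P a → colour a < t) →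
               Clique R P (suc (t * m)) → ∃[ c ] Clique R (λ a → P a × colour a ≡ c) (suc m)
  pigeonhole colour {zero} bounded K with inhabited K
  ... | _ , Pa with () ← bounded Pa
  pigeonhole colour {suc t} {m} bounded K
    with split (λ a → colour a ≟ t) {m} {suc (t * m)} (shrink (≤-reflexive (+-suc m (t * m))) K)
  ... | inj₁ K′ = t , K′
  ... | inj₂ K′ with pigeonhole colour (λ (Pa , c≢t) → ≤∧≢⇒< (≤-pred (bounded Pa)) c≢t) K′
  ...   | c , K″ = c , weaken (λ ((Pa , _) , c≡) → Pa , c≡) K″

  maximal : ∀ {P m} (key : A → ℕ) → Clique R P (suc m) →
            ∃[ a ] (P a × Clique R (λ b → P b × key b ≤ key a) (suc m))
  maximal key record { members = x ∷ xs ; pairwise = Rxs ; all = Px ∷ Pxs ; size = size } =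
      argmax key x xs , argmax-all key Px Pxs
    , record { members = x ∷ xs ; pairwise = Rxs ; size = size
             ; all = All.zip (Px ∷ Pxs , f[⊥]≤f[argmax] {f = key} x xs ∷ f[xs]≤f[argmax] x xs) }

module _ {A : Set} {R S : Rel A 0ℓ} {P : Pred A 0ℓ} (d : ℕ)
  (peel : ∀ {Q m} → Q ⊆ P → Clique R Q (d + m) → ∃[ a ] (Q a × Clique R (λ b → Q b × S a b) m))
  where

  greedy : ∀ r {Q} → Q ⊆ P → Clique R Q (r * d) → Clique S Q r
  greedy zero _ _ = record { members = [] ; pairwise = [] ; all = [] ; size = z≤n }
  greedy (suc r) Q⊆P K with peel Q⊆P K
  ... | a , Qa , K′ = cons Qa (greedy r (λ (Qb , _) → Q⊆P Qb) K′)

Distinct : ∀ {A : Set} → ℕ → Pred A 0ℓ → Set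
Distinct {A} m P = Σ (Fin m → A) λ g → Injective _≡_ _≡_ g × (∀ i → P (g i))

Distinct-shrink : ∀ {A : Set} {P : Pred A 0ℓ} {m m′} → m ≤ m′ → Distinct m′ P → Distinct m P
Distinct-shrink m≤m′ (g , g-inj , Pg) =
    (λ i → g (inject≤ i m≤m′))
  , (λ e → inject≤-injective _ _ _ _ (g-inj e))
  , (λ i → Pg (inject≤ i m≤m′))

Distinct-weaken : ∀ {A : Set} {P Q : Pred A 0ℓ} {m} → P ⊆ Q → Distinct m P → Distinct m Q
Distinct-weaken P⊆Q (g , g-inj , Pg) = g , g-inj , λ i → P⊆Q (Pg i)

clique⇒distinct : ∀ {A : Set} {P : Pred A 0ℓ} {m} → Clique _≢_ P m → Distinct m P
clique⇒distinct K with pick (λ x≢y y≡x → x≢y (sym y≡x)) K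
... | g , distinct , Pg =
  g , (λ {i} {j} gi≡gj → decidable-stable (i ≟ᶠ j) (λ i≢j → distinct i≢j gi≡gj)) , Pg

tabulate-clique : ∀ {A : Set} {R : Rel A 0ℓ} {P : Pred A 0ℓ} {m} (g : Fin m → A) →
                  (∀ {i j} → i ≢ j → R (g i) (g j)) → (∀ i → P (g i)) → Clique R P m
tabulate-clique g Rg Pg = record
  { members = tabulate g ; pairwise = AllPairsₚ.tabulate⁺ Rg ; all = Allₚ.tabulate⁺ Pg
  ; size = ≤-reflexive (sym (length-tabulate g)) }

allFin-clique : ∀ n → Clique _≢_ U n
allFin-clique n = tabulate-clique id id (λ _ → tt)

all⊎any : ∀ {n} {A B : Pred (Fin n) 0ℓ} → (∀ i → A i ⊎ B i) → (∀ i → A i) ⊎ ∃ B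
all⊎any {zero}  _ = inj₁ λ ()
all⊎any {suc n} A⊎B with A⊎B zero | all⊎any (A⊎B ∘ suc)
... | inj₂ b | _            = inj₂ (zero , b)
... | inj₁ a | inj₁ as      = inj₁ λ { zero → a ; (suc i) → as i }
... | inj₁ _ | inj₂ (i , b) = inj₂ (suc i , b)

another : ∀ {β} → 2 ≤ β → (p : Fin β) → ∃[ q ] q ≢ p
another (s≤s (s≤s z≤n)) zero     = suc zero , λ ()
another (s≤s (s≤s z≤n)) (suc _)  = zero , λ ()

join-injective : ∀ m n {s t} → join m n s ≡ join m n t → s ≡ t
join-injective m n {s} {t} e = begin
  s                         ≡⟨ sym (splitAt-join m n s) ⟩
  splitAt m (join m n s)    ≡⟨ cong (splitAt m) e ⟩
  splitAt m (join m n t)    ≡⟨ splitAt-join m n t ⟩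
  t                         ∎
  where open ≡-Reasoning

-- T(δ) as a star of brooms

module _ (G : Graph) (δ : ℕ) where

  private
    V : Set
    V = Fin (N G)
    _~_ : V → V → Set
    _~_ = _∼_ G

  record Broom₁ (h : V) (R : Pred V 0ℓ) : Set where
    field
      base        : V
      leaf        : Fin δ → V
      base∈       : R base
      leaf∈       : ∀ j → R (leaf j)
      h~base      : h ~ base
      h≁leaf      : ∀ j → ¬ h ~ leaf j
      base~leaf   : ∀ j → base ~ leaf j
      leaf-stable : ∀ j j′ → ¬ leaf j ~ leaf j′
      leaf-inj    : Injective _≡_ _≡_ leaf

  record Broom₂ (h : V) (R : Pred V 0ℓ) : Set where
    field
      mid         : V
      base        : V
      leaf        : Fin δ → V
      mid∈        : R mid
      base∈       : R base
      leaf∈       : ∀ j → R (leaf j)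
      h~mid       : h ~ mid
      h≁base      : ¬ h ~ base
      h≁leaf      : ∀ j → ¬ h ~ leaf j
      mid~base    : mid ~ base
      mid≁leaf    : ∀ j → ¬ mid ~ leaf j
      base~leaf   : ∀ j → base ~ leaf j
      leaf-stable : ∀ j j′ → ¬ leaf j ~ leaf j′
      leaf-inj    : Injective _≡_ _≡_ leaf

  Branch : Set
  Branch = Fin δ ⊎ Fin δ

  _≟ᵇ_ : (s t : Branch) → Dec (s ≡ t)
  _≟ᵇ_ = ≡-dec⊎ _≟ᶠ_ _≟ᶠ_

  data _∈Branch_ : TV δ → Branch → Set where
    base₁ : ∀ {i} → b1 i ∈Branch inj₁ i
    leaf₁ : ∀ {i} j → l1 i j ∈Branch inj₁ i
    mid₂  : ∀ {i} → m2 i ∈Branch inj₂ i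
    base₂ : ∀ {i} → b2 i ∈Branch inj₂ i
    leaf₂ : ∀ {i} j → l2 i j ∈Branch inj₂ i

  data Position : TV δ → Set where
    centre : Position hub
    branch : ∀ {u} s → u ∈Branch s → Position u

  position : ∀ u → Position u
  position hub      = centre
  position (b1 i)   = branch _ base₁
  position (l1 i j) = branch _ (leaf₁ j)
  position (m2 i)   = branch _ mid₂
  position (b2 i)   = branch _ base₂
  position (l2 i j) = branch _ (leaf₂ j)

  module StarOfBrooms {h : V} (Region : Branch → Pred V 0ℓ)
    (separated : ∀ {s t} → s ≢ t → ∀ {x y} → Region s x → Region t y → x ≢ y × ¬ x ~ y)
    (h∉ : ∀ s → ¬ Region s h)
    (broom₁ : ∀ i → Broom₁ h (Region (inj₁ i)))
    (broom₂ : ∀ i → Broom₂ h (Region (inj₂ i)))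
    where

    module B₁ (i : Fin δ) = Broom₁ (broom₁ i)
    module B₂ (i : Fin δ) = Broom₂ (broom₂ i)

    embed : TV δ → V
    embed hub      = h
    embed (b1 i)   = B₁.base i
    embed (l1 i j) = B₁.leaf i j
    embed (m2 i)   = B₂.mid i
    embed (b2 i)   = B₂.base i
    embed (l2 i j) = B₂.leaf i j

    embed∈ : ∀ {u s} → u ∈Branch s → Region s (embed u)
    embed∈ {s = inj₁ i} base₁     = B₁.base∈ i
    embed∈ {s = inj₁ i} (leaf₁ j) = B₁.leaf∈ i j
    embed∈ {s = inj₂ i} mid₂      = B₂.mid∈ i
    embed∈ {s = inj₂ i} base₂     = B₂.base∈ i
    embed∈ {s = inj₂ i} (leaf₂ j) = B₂.leaf∈ i j

    adjacent⇒distinct : ∀ {x y} → x ~ y → x ≢ y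
    adjacent⇒distinct x~x refl = ∼-irr G x~x

    h-separates : ∀ {x y} → h ~ x → ¬ h ~ y → x ≢ y
    h-separates h~x h≁x refl = h≁x h~x

    within-injective : ∀ {u v s} → u ∈Branch s → v ∈Branch s → embed u ≡ embed v → u ≡ v
    within-injective base₁ base₁ _ = refl
    within-injective {s = inj₁ i} base₁ (leaf₁ j) e =
      ⊥-elim (h-separates (B₁.h~base i) (B₁.h≁leaf i j) e)
    within-injective {s = inj₁ i} (leaf₁ j) base₁ e =
      ⊥-elim (h-separates (B₁.h~base i) (B₁.h≁leaf i j) (sym e))
    within-injective {s = inj₁ i} (leaf₁ j) (leaf₁ j′) e = cong (l1 i) (B₁.leaf-inj i e)
    within-injective mid₂ mid₂ _ = refl
    within-injective {s = inj₂ i} mid₂ base₂ e =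
      ⊥-elim (h-separates (B₂.h~mid i) (B₂.h≁base i) e)
    within-injective {s = inj₂ i} mid₂ (leaf₂ j) e =
      ⊥-elim (h-separates (B₂.h~mid i) (B₂.h≁leaf i j) e)
    within-injective {s = inj₂ i} base₂ mid₂ e =
      ⊥-elim (h-separates (B₂.h~mid i) (B₂.h≁base i) (sym e))
    within-injective base₂ base₂ _ = refl
    within-injective {s = inj₂ i} base₂ (leaf₂ j) e =
      ⊥-elim (adjacent⇒distinct (B₂.base~leaf i j) e)
    within-injective {s = inj₂ i} (leaf₂ j) mid₂ e =
      ⊥-elim (h-separates (B₂.h~mid i) (B₂.h≁leaf i j) (sym e))
    within-injective {s = inj₂ i} (leaf₂ j) base₂ e =
      ⊥-elim (adjacent⇒distinct (B₂.base~leaf i j) (sym e))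
    within-injective {s = inj₂ i} (leaf₂ j) (leaf₂ j′) e = cong (l2 i) (B₂.leaf-inj i e)

    within-reflects : ∀ {u v s} → u ∈Branch s → v ∈Branch s → embed u ~ embed v → TAdj δ u v
    within-reflects base₁ base₁ a = ⊥-elim (∼-irr G a)
    within-reflects {s = inj₁ i} base₁ (leaf₁ j) _ = inj₁ (e-b1-l1 i j)
    within-reflects {s = inj₁ i} (leaf₁ j) base₁ _ = inj₂ (e-b1-l1 i j)
    within-reflects {s = inj₁ i} (leaf₁ j) (leaf₁ j′) a = ⊥-elim (B₁.leaf-stable i j j′ a)
    within-reflects mid₂ mid₂ a = ⊥-elim (∼-irr G a)
    within-reflects {s = inj₂ i} mid₂ base₂ _ = inj₁ (e-m2-b2 i)
    within-reflects {s = inj₂ i} mid₂ (leaf₂ j) a = ⊥-elim (B₂.mid≁leaf i j a)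
    within-reflects {s = inj₂ i} base₂ mid₂ _ = inj₂ (e-m2-b2 i)
    within-reflects base₂ base₂ a = ⊥-elim (∼-irr G a)
    within-reflects {s = inj₂ i} base₂ (leaf₂ j) _ = inj₁ (e-b2-l2 i j)
    within-reflects {s = inj₂ i} (leaf₂ j) mid₂ a = ⊥-elim (B₂.mid≁leaf i j (∼-sym G a))
    within-reflects {s = inj₂ i} (leaf₂ j) base₂ _ = inj₂ (e-b2-l2 i j)
    within-reflects {s = inj₂ i} (leaf₂ j) (leaf₂ j′) a = ⊥-elim (B₂.leaf-stable i j j′ a)

    centre-reflects : ∀ {u s} → u ∈Branch s → h ~ embed u → TAdj δ hub u
    centre-reflects {s = inj₁ i} base₁     _ = inj₁ (e-hub-b1 i)
    centre-reflects {s = inj₁ i} (leaf₁ j) a = ⊥-elim (B₁.h≁leaf i j a)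
    centre-reflects {s = inj₂ i} mid₂      _ = inj₁ (e-hub-m2 i)
    centre-reflects {s = inj₂ i} base₂     a = ⊥-elim (B₂.h≁base i a)
    centre-reflects {s = inj₂ i} (leaf₂ j) a = ⊥-elim (B₂.h≁leaf i j a)

    embed-injective : Injective _≡_ _≡_ embed
    embed-injective {u} {v} e with position u | position v
    ... | centre     | centre     = refl
    ... | centre     | branch t q = ⊥-elim (h∉ t (subst (Region t) (sym e) (embed∈ q)))
    ... | branch s p | centre     = ⊥-elim (h∉ s (subst (Region s) e (embed∈ p)))
    ... | branch s p | branch t q with s ≟ᵇ t
    ...   | yes refl = within-injective p q e
    ...   | no s≢t   = ⊥-elim (proj₁ (separated s≢t (embed∈ p) (embed∈ q)) e)

    embed-preserves-edge : ∀ u v → TEdge δ u v → embed u ~ embed v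
    embed-preserves-edge _ _ (e-hub-b1 i)  = B₁.h~base i
    embed-preserves-edge _ _ (e-b1-l1 i j) = B₁.base~leaf i j
    embed-preserves-edge _ _ (e-hub-m2 i)  = B₂.h~mid i
    embed-preserves-edge _ _ (e-m2-b2 i)   = B₂.mid~base i
    embed-preserves-edge _ _ (e-b2-l2 i j) = B₂.base~leaf i j

    embed-preserves : ∀ u v → TAdj δ u v → embed u ~ embed v
    embed-preserves u v (inj₁ e) = embed-preserves-edge u v e
    embed-preserves u v (inj₂ e) = ∼-sym G (embed-preserves-edge v u e)

    embed-reflects : ∀ u v → embed u ~ embed v → TAdj δ u v
    embed-reflects u v a with position u | position v
    ... | centre     | centre     = ⊥-elim (∼-irr G a)
    ... | centre     | branch t q = centre-reflects q a
    ... | branch s p | centre     = swap (centre-reflects p (∼-sym G a))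
    ... | branch s p | branch t q with s ≟ᵇ t
    ...   | yes refl = within-reflects p q a
    ...   | no s≢t   = ⊥-elim (proj₂ (separated s≢t (embed∈ p) (embed∈ q)) a)

    T-copy : InducedCopy G (TV δ) (TAdj δ)
    T-copy = record
      { f = embed ; f-inj = embed-injective ; pres = embed-preserves ; refl' = embed-reflects }

-- Brooms inside a core

≥NonNbrsInPart : ∀ {G a b} → ℕ → Fin (N G) → Core G a b → Fin b → Set
≥NonNbrsInPart {G} k v Y p = Distinct k λ j → ¬ _∼_ G v (y Y p j)

module _ {G : Graph} {ζ β : ℕ} (Y : Core G ζ β) where

  private
    V : Set
    V = Fin (N G)
    _~_ : V → V → Set
    _~_ = _∼_ G

  Touches : Pred V 0ℓ
  Touches u = ∃[ p ] ∃[ j ] u ~ y Y p j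

  touches? : Decidable Touches
  touches? u = any? λ p → any? λ j → ∼-dec G u (y Y p j)

  Sparse : ℕ → Pred V 0ℓ
  Sparse m u = ∀ p → ¬ ≥NbrsInPart m u Y p

  part-dichotomy : ∀ {m k} u p → m + k ≤ ζ →
                   ≥NbrsInPart (suc m) u Y p ⊎ ≥NonNbrsInPart k u Y p
  part-dichotomy u p m+k≤ζ
    with split (λ j → ∼-dec G u (y Y p j)) (shrink m+k≤ζ (allFin-clique ζ))
  ... | inj₁ K = inj₁ (Distinct-weaken {Q = λ j → u ~ y Y p j} proj₂ (clique⇒distinct K))
  ... | inj₂ K = inj₂ (Distinct-weaken {Q = λ j → ¬ u ~ y Y p j} proj₂ (clique⇒distinct K))

  ≥NbrsInPart-shrink : ∀ {m m′ u p} → m ≤ m′ → ≥NbrsInPart m′ u Y p → ≥NbrsInPart m u Y p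
  ≥NbrsInPart-shrink {u = u} {p} = Distinct-shrink {P = λ j → u ~ y Y p j}

  ¬≥Nbrs⇒≥NonNbrs : ∀ {m k u p} → ¬ ≥NbrsInPart m u Y p → m + k ≤ ζ → ≥NonNbrsInPart k u Y p
  ¬≥Nbrs⇒≥NonNbrs {u = u} {p} few m+k≤ζ with part-dichotomy u p m+k≤ζ
  ... | inj₁ many = ⊥-elim (few (≥NbrsInPart-shrink (n≤1+n _) many))
  ... | inj₂ far  = far

  ¬Dense⇒≥NonNbrs : ∀ {α k u} → ¬ Templates.Dense G α u Y → α + k ≤ ζ →
                    ∃[ q ] ≥NonNbrsInPart k u Y q
  ¬Dense⇒≥NonNbrs {α} {u = u} ¬dense α+k≤ζ with all⊎any (λ p → part-dichotomy u p α+k≤ζ)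
  ... | inj₂ far  = far
  ... | inj₁ many = ⊥-elim (¬dense (u∉Y , λ p → ≥NbrsInPart-shrink (n≤1+n α) (many p)))
    where
    u∉Y : ¬ InCore Y u
    u∉Y (q , j , refl) = stable Y q j (proj₁ (many q) zero) (proj₂ (proj₂ (many q)) zero)

  record Foothold (k : ℕ) (w : V) : Set where
    field
      near far : Fin β
      near≢far : near ≢ far
      anchor   : Fin ζ
      w~anchor : w ~ y Y near anchor
      avoided  : ≥NonNbrsInPart k w Y far

  foothold : ∀ {k w p q} → 2 ≤ β → k ≤ ζ →
             ≥NbrsInPart 1 w Y p → ≥NonNbrsInPart k w Y q → Foothold k w
  foothold {w = w} {p} {q} 2≤β k≤ζ (j , _ , w~j) avoided with p ≟ᶠ q
  ... | no p≢q = record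
    { near = p ; far = q ; near≢far = p≢q ; anchor = j zero ; w~anchor = w~j zero
    ; avoided = avoided }
  ... | yes refl with another 2≤β p
  ...   | p′ , p′≢p with part-dichotomy {m = 0} w p′ k≤ζ
  ...     | inj₁ (j′ , _ , w~j′) = record
    { near = p′ ; far = p ; near≢far = p′≢p ; anchor = j′ zero ; w~anchor = w~j′ zero
    ; avoided = avoided }
  ...     | inj₂ avoided′ = record
    { near = p ; far = p′ ; near≢far = p′≢p ∘ sym ; anchor = j zero ; w~anchor = w~j zero
    ; avoided = avoided′ }

  y-injective-in-part : ∀ {k p} {g : Fin k → Fin ζ} →
                        Injective _≡_ _≡_ g → Injective _≡_ _≡_ (y Y p ∘ g)
  y-injective-in-part g-inj e = g-inj (proj₂ (y-inj Y _ _ _ _ e))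

  Near : V → Pred V 0ℓ
  Near w x = x ≡ w ⊎ InCore Y x

  module _ {δ : ℕ} where

    broom₁-in-core : ∀ {u p q j} → u ~ y Y p j → p ≢ q → ≥NonNbrsInPart δ u Y q →
                     Broom₁ G δ u (InCore Y)
    broom₁-in-core {p = p} {q} {j} u~y p≢q (g , g-inj , u≁) = record
      { base = y Y p j ; leaf = y Y q ∘ g ; base∈ = p , j , refl ; leaf∈ = λ a → q , g a , refl
      ; h~base = u~y ; h≁leaf = u≁ ; base~leaf = λ a → complete Y p q j (g a) p≢q
      ; leaf-stable = λ a a′ → stable Y q (g a) (g a′) ; leaf-inj = y-injective-in-part g-inj }

    broom₂-in-core : ∀ {u p q j j′} → u ~ y Y p j → p ≢ q → ¬ u ~ y Y q j′ →
                     ≥NonNbrsInPart δ u Y p → Broom₂ G δ u (InCore Y)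
    broom₂-in-core {p = p} {q} {j} {j′} u~y p≢q u≁y′ (g , g-inj , u≁) = record
      { mid = y Y p j ; base = y Y q j′ ; leaf = y Y p ∘ g
      ; mid∈ = p , j , refl ; base∈ = q , j′ , refl ; leaf∈ = λ a → p , g a , refl
      ; h~mid = u~y ; h≁base = u≁y′ ; h≁leaf = u≁
      ; mid~base = complete Y p q j j′ p≢q ; mid≁leaf = λ a → stable Y p j (g a)
      ; base~leaf = λ a → complete Y q p j′ (g a) (p≢q ∘ sym)
      ; leaf-stable = λ a a′ → stable Y p (g a) (g a′) ; leaf-inj = y-injective-in-part g-inj }

    broom₁-through : ∀ {v w p} → v ~ w → ¬ Touches v → ≥NbrsInPart δ w Y p → Broom₁ G δ v (Near w)
    broom₁-through {p = p} v~w v-far (g , g-inj , w~) = record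
      { base = _ ; leaf = y Y p ∘ g ; base∈ = inj₁ refl ; leaf∈ = λ a → inj₂ (p , g a , refl)
      ; h~base = v~w ; h≁leaf = λ a v~ → v-far (p , g a , v~) ; base~leaf = w~
      ; leaf-stable = λ a a′ → stable Y p (g a) (g a′) ; leaf-inj = y-injective-in-part g-inj }

    broom₂-through : ∀ {v w} → v ~ w → ¬ Touches v → Foothold δ w → Broom₂ G δ v (Near w)
    broom₂-through v~w v-far record
      { near = near ; far = far ; near≢far = near≢far ; anchor = anchor ; w~anchor = w~anchor
      ; avoided = g , g-inj , w≁ } = record
      { mid = _ ; base = y Y near anchor ; leaf = y Y far ∘ g
      ; mid∈ = inj₁ refl ; base∈ = inj₂ (near , anchor , refl) ; leaf∈ = λ a → inj₂ (far , g a , refl)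
      ; h~mid = v~w ; h≁base = λ v~ → v-far (near , anchor , v~)
      ; h≁leaf = λ a v~ → v-far (far , g a , v~)
      ; mid~base = w~anchor ; mid≁leaf = w≁
      ; base~leaf = λ a → complete Y near far anchor (g a) near≢far
      ; leaf-stable = λ a a′ → stable Y far (g a) (g a′) ; leaf-inj = y-injective-in-part g-inj }

    sparse-broom₁ : ∀ {η u} → 2 ≤ β → η + δ ≤ ζ → Touches u → Sparse η u →
                    Broom₁ G δ u (InCore Y)
    sparse-broom₁ 2≤β η+δ≤ζ (p , j , u~y) sparse with another 2≤β p
    ... | q , q≢p = broom₁-in-core u~y (q≢p ∘ sym) (¬≥Nbrs⇒≥NonNbrs (sparse q) η+δ≤ζ)

    sparse-broom₂ : ∀ {η u} → 1 ≤ δ → 2 ≤ β → η + δ ≤ ζ → Touches u → Sparse η u →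
                    Broom₂ G δ u (InCore Y)
    sparse-broom₂ 1≤δ 2≤β η+δ≤ζ (p , j , u~y) sparse with another 2≤β p
    ... | q , q≢p with ¬≥Nbrs⇒≥NonNbrs (sparse q) η+δ≤ζ
    ...   | _ , _ , u≁ =
      broom₂-in-core u~y (q≢p ∘ sym) (u≁ (fromℕ< 1≤δ)) (¬≥Nbrs⇒≥NonNbrs (sparse p) η+δ≤ζ)

module TemplateArrayProperties {G : Graph} {α ζ η β : ℕ} (T : Templates.TemplateArray G α ζ η β) where

  open Templates G α
  open TemplateArray T

  private
    V : Set
    V = Fin (N G)
    _~_ : V → V → Set
    _~_ = _∼_ G

  H-disjoint : ∀ {i i′ x} → i ≢ i′ → H i x → ¬ H i′ x
  H-disjoint {i} {i′} {x} i≢i′ x∈Hᵢ x∈Hᵢ′ with <-cmp i i′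
  ... | tri< i<i′ _ _ = disj i i′ i<i′ x x∈Hᵢ x∈Hᵢ′
  ... | tri≈ _ i≡i′ _ = i≢i′ i≡i′
  ... | tri> _ _ i′<i = disj i′ i i′<i x x∈Hᵢ′ x∈Hᵢ

  cores-anticomplete : ∀ {i i′} → i ≢ i′ → ∀ {x x′} → InCore (Y i) x → InCore (Y i′) x′ → ¬ x ~ x′
  cores-anticomplete {i} {i′} i≢i′ {x} {x′} x∈ x′∈ x~x′ with <-cmp i i′
  ... | tri< i<i′ _ _ = noEdge i i′ i<i′ x x′ (Y⊆H i x x∈) x′∈ x~x′
  ... | tri≈ _ i≡i′ _ = i≢i′ i≡i′
  ... | tri> _ _ i′<i = noEdge i′ i i′<i x′ x (Y⊆H i′ x′ x′∈) x∈ (∼-sym G x~x′)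

  cores-separated : ∀ {i i′} → i ≢ i′ → ∀ {x x′} → InCore (Y i) x → InCore (Y i′) x′ →
                    x ≢ x′ × ¬ x ~ x′
  cores-separated {i} {i′} i≢i′ x∈ x′∈ =
    (λ { refl → H-disjoint i≢i′ (Y⊆H i _ x∈) (Y⊆H i′ _ x′∈) }) , cores-anticomplete i≢i′ x∈ x′∈

  Tame : V → Fin n → Set
  Tame u i = ¬ InCore (Y i) u × (Touches (Y i) u → Sparse (Y i) η u)

  Hub : V → Fin n → Set
  Hub u i = ¬ InCore (Y i) u × Touches (Y i) u × Sparse (Y i) η u

  tame⇒hub : ∀ {u i} → Tame u i → Touches (Y i) u → Hub u i
  tame⇒hub (u∉Y , sparse) touches = u∉Y , touches , sparse touches

  module _ (cleaned : OneCleaned) where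

    sparse-unless-mixed : ∀ {u i} → VT u → ¬ Mixed η u (Y i) → Sparse (Y i) η u
    sparse-unless-mixed {u} {i} u∈T ¬mixed p nbrs = ¬mixed (cleaned i u u∈T , p , nbrs)

    tame-below : ∀ {i i′ u} → H i u → i′ <ᶠ i → Tame u i′
    tame-below {i} {i′} {u} u∈H i′<i =
        (λ u∈Y → disj i′ i i′<i u (Y⊆H i′ u u∈Y) u∈H)
      , (λ _ → sparse-unless-mixed (inj₁ (i , u∈H)) (noMixBack i′ i i′<i u u∈H))

    tame-away-from-home : ∀ {u} → VT u → ∃[ home ] (∀ i → home ≢ just i → Tame u i)
    tame-away-from-home {u} (inj₁ (j , u∈Hⱼ)) = just j , tame
      where
      tame : ∀ i → just j ≢ just i → Tame u i
      tame i j≢i with <-cmp i j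
      ... | tri< i<j _ _ = tame-below u∈Hⱼ i<j
      ... | tri≈ _ i≡j _ = ⊥-elim (j≢i (cong just (sym i≡j)))
      ... | tri> _ _ j<i = (λ u∈Y → H-disjoint (j≢i ∘ cong just ∘ sym) (Y⊆H i u u∈Y) u∈Hⱼ)
                         , (λ (p , k , u~y) → ⊥-elim (noEdge j i j<i u _ u∈Hⱼ (p , k , refl) u~y))
    tame-away-from-home {u} (inj₂ u∈U) = nothing , λ i _ →
        (λ u∈Y → U-notH u u∈U i (Y⊆H i u u∈Y))
      , (λ _ → sparse-unless-mixed (inj₂ u∈U) (U-notMix u u∈U i))

  Independent : Rel (Fin n × V) 0ℓ
  Independent (i , w) (i′ , w′) = i ≢ i′ × ¬ w ~ w′ × ¬ Touches (Y i′) w × ¬ Touches (Y i) w′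

  Independent-sym : Symmetric Independent
  Independent-sym (i≢i′ , w≁w′ , w-far , w′-far) = i≢i′ ∘ sym , w≁w′ ∘ ∼-sym G , w′-far , w-far

  Remote : V → Pred (Fin n × V) 0ℓ
  Remote v (i , w) = H i w × v ~ w × ¬ Touches (Y i) v × ¬ InCore (Y i) v

  near⊆H : ∀ {i w x} → H i w → Near (Y i) w x → H i x
  near⊆H w∈H (inj₁ refl) = w∈H
  near⊆H w∈H (inj₂ x∈Y)  = Y⊆H _ _ x∈Y

  near-anticomplete : ∀ {i w i′ w′} → Independent (i , w) (i′ , w′) →
                      ∀ {x x′} → Near (Y i) w x → Near (Y i′) w′ x′ → ¬ x ~ x′
  near-anticomplete (_ , w≁w′ , _ , _) (inj₁ refl) (inj₁ refl) = w≁w′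
  near-anticomplete (_ , _ , w-far , _) (inj₁ refl) (inj₂ (p , j , refl)) x~x′ = w-far (p , j , x~x′)
  near-anticomplete (_ , _ , _ , w′-far) (inj₂ (p , j , refl)) (inj₁ refl) x~x′ =
    w′-far (p , j , ∼-sym G x~x′)
  near-anticomplete (i≢i′ , _) (inj₂ x∈Y) (inj₂ x′∈Y) = cores-anticomplete i≢i′ x∈Y x′∈Y

  module _ {δ : ℕ} (T-free : TFree δ G) (1≤δ : 1 ≤ δ) (2≤β : 2 ≤ β) where

    hub-refuted : η + δ ≤ ζ → ∀ u → ¬ Clique _≢_ (Hub u) (δ + δ)
    hub-refuted η+δ≤ζ u K with pick (λ i≢j → i≢j ∘ sym) K
    ... | g , distinct , at-hub = T-free (StarOfBrooms.T-copy G δ Region separated h∉ broom₁ broom₂)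
      where
      core : Branch G δ → Fin n
      core s = g (join δ δ s)
      Region : Branch G δ → Pred V 0ℓ
      Region s = InCore (Y (core s))
      separated : ∀ {s t} → s ≢ t → ∀ {x y} → Region s x → Region t y → x ≢ y × ¬ x ~ y
      separated s≢t = cores-separated (distinct (s≢t ∘ join-injective δ δ))
      h∉ : ∀ s → ¬ Region s u
      h∉ s = proj₁ (at-hub (join δ δ s))
      broom₁ : ∀ i → Broom₁ G δ u (Region (inj₁ i))
      broom₁ i with at-hub (join δ δ (inj₁ i))
      ... | _ , touches , sparse = sparse-broom₁ (Y (core (inj₁ i))) 2≤β η+δ≤ζ touches sparse
      broom₂ : ∀ i → Broom₂ G δ u (Region (inj₂ i))
      broom₂ i with at-hub (join δ δ (inj₂ i))
      ... | _ , touches , sparse = sparse-broom₂ (Y (core (inj₂ i))) 1≤δ 2≤β η+δ≤ζ touches sparse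

    remote-refuted : δ ≤ η → α + δ ≤ ζ → ∀ v → ¬ Clique Independent (Remote v) (δ + δ)
    remote-refuted δ≤η α+δ≤ζ v K with pick Independent-sym K
    ... | g , independent , remote = T-free (StarOfBrooms.T-copy G δ Region separated h∉ broom₁ broom₂)
      where
      witness : Branch G δ → Fin n × V
      witness s = g (join δ δ s)
      Region : Branch G δ → Pred V 0ℓ
      Region s = Near (Y (proj₁ (witness s))) (proj₂ (witness s))
      separated : ∀ {s t} → s ≢ t → ∀ {x y} → Region s x → Region t y → x ≢ y × ¬ x ~ y
      separated {s} {t} s≢t x∈ y∈ with independent (s≢t ∘ join-injective δ δ)
      ... | indep@(i≢i′ , _) =
          (λ { refl → H-disjoint i≢i′ (near⊆H (proj₁ (remote _)) x∈) (near⊆H (proj₁ (remote _)) y∈) })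
        , near-anticomplete indep x∈ y∈
      h∉ : ∀ s → ¬ Region s v
      h∉ s v∈ with remote (join δ δ s) | v∈
      ... | _ , v~w , _      | inj₁ refl = ∼-irr G v~w
      ... | _ , _ , _ , v∉Y  | inj₂ v∈Y  = v∉Y v∈Y
      broom₁ : ∀ i → Broom₁ G δ v (Region (inj₁ i))
      broom₁ i with remote (join δ δ (inj₁ i))
      ... | w∈H , v~w , v-far , _ with H-mix _ _ w∈H
      ...   | _ , _ , nbrs = broom₁-through (Y _) v~w v-far (≥NbrsInPart-shrink (Y _) δ≤η nbrs)
      broom₂ : ∀ i → Broom₂ G δ v (Region (inj₂ i))
      broom₂ i with remote (join δ δ (inj₂ i))
      ... | w∈H , v~w , v-far , _ with H-mix _ _ w∈H
      ...   | ¬dense , _ , nbrs = broom₂-through (Y _) v~w v-far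
                (foothold (Y _) 2≤β (≤-trans (m≤n+m δ α) α+δ≤ζ)
                   (≥NbrsInPart-shrink (Y _) (≤-trans 1≤δ δ≤η) nbrs)
                   (proj₂ (¬Dense⇒≥NonNbrs (Y _) ¬dense α+δ≤ζ)))

-- Counting witnesses

γ-expanded : ∀ δ τ →
             (2 * δ * τ + 1) * (2 * δ + 1) ≡ suc ((δ + δ) + τ * ((δ + δ) * (δ + δ))) + (δ + δ) * τ
γ-expanded = solve-∀

-- One index may be v's home, fewer than 2δ cores are touched by v, and τ (2δ)² + 1 witnesses remain
-- to be sorted by colour.
γ-fits : ∀ δ′ τ → let δ = suc δ′; d = δ + δ in suc (δ′ + δ + suc (τ * (d * d))) ≤ γ δ τ
γ-fits δ′ τ = begin
  suc (δ′ + δ + suc (τ * (d * d)))   ≡⟨ cong suc (+-suc (δ′ + δ) _) ⟩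
  suc (d + τ * (d * d))              ≤⟨ m≤m+n _ (d * τ) ⟩
  suc (d + τ * (d * d)) + d * τ      ≡⟨ sym (γ-expanded δ τ) ⟩
  γ δ τ                              ∎
  where
  open ≤-Reasoning
  δ d : ℕ
  δ = suc δ′
  d = δ + δ

-- δ is taken to be suc δ′ so that δ + δ is a successor, as the sharp counting of split requires.
module _ {G : Graph} {τ α δ′ β ζ η : ℕ} (T : Templates.TemplateArray G α ζ η β)
  (cleaned : Templates.TemplateArray.OneCleaned T)
  (T-free : TFree (suc δ′) G) (χ²≤τ : χ²≤ G τ) (2≤β : 2 ≤ β)
  (δ≤η : suc δ′ ≤ η) (η+δ≤ζ : η + suc δ′ ≤ ζ) (α+δ≤ζ : α + suc δ′ ≤ ζ)
  (v : Fin (N G)) (v∈T : Templates.TemplateArray.VT T v)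
  where

  open Templates G α
  open TemplateArray T
  open TemplateArrayProperties T

  private
    V : Set
    V = Fin (N G)
    _~_ : V → V → Set
    _~_ = _∼_ G
    δ d : ℕ
    δ = suc δ′
    d = δ + δ
    Witness : Set
    Witness = Fin n × V

  Attached : Pred Witness 0ℓ
  Attached (i , w) = H i w × v ~ w

  DistinctIndex : Rel Witness 0ℓ
  DistinctIndex = _≢_ on proj₁

  Candidate : Pred Witness 0ℓ
  Candidate (i , w) = Attached (i , w) × Tame v i

  away-from-home : ∀ {m} → Clique DistinctIndex Attached (suc m) → Clique DistinctIndex Candidate m
  away-from-home K with tame-away-from-home cleaned v∈T
  ... | home , tame with split (λ (i , _) → ≡-decᴹ _≟ᶠ_ home (just i)) {1} K
  ...   | inj₁ twins = ⊥-elim (no-pair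
            (λ (_ , at-home) (_ , at-home′) i≢i′ → i≢i′ (just-injective (trans (sym at-home) at-home′)))
            twins)
  ...   | inj₂ K′ = weaken (λ (attached , away) → attached , tame _ away) K′

  remote : ∀ {m} → Clique DistinctIndex Candidate (δ′ + δ + m) → Clique DistinctIndex (Remote v) m
  remote {m} K with split (λ (i , _) → touches? (Y i) v) {δ′ + δ} {m} K
  ... | inj₁ touching = ⊥-elim (hub-refuted T-free (s≤s z≤n) 2≤β η+δ≤ζ v
          (image proj₁ id (λ ((_ , tame) , touches) → tame⇒hub tame touches) touching))
  ... | inj₂ K′ = weaken (λ (((w∈H , v~w) , v∉Y , _) , v-far) → w∈H , v~w , v-far , v∉Y) K′

  colouring : Colourable G (N² G v) τ
  colouring = χ²≤τ v

  colour : V → ℕ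
  colour w = toℕ (proj₁ colouring w)

  same-colour⇒non-adjacent : ∀ {w w′} → v ~ w → v ~ w′ → colour w ≡ colour w′ → ¬ w ~ w′
  same-colour⇒non-adjacent v~w v~w′ same w~w′ =
    proj₂ colouring _ _ (inj₂ (inj₁ v~w)) (inj₂ (inj₁ v~w′)) w~w′ (toℕ-injective same)

  module _ (c₀ : ℕ) where

    Pool : Pred Witness 0ℓ
    Pool (i , w) = Remote v (i , w) × colour w ≡ c₀

    hub-below : ∀ {i w i′} → Pool (i , w) → i′ <ᶠ i → Touches (Y i′) w → Hub w i′
    hub-below ((w∈H , _) , _) i′<i = tame⇒hub (tame-below cleaned w∈H i′<i)

    independent-below : ∀ {i w i′ w′} → Pool (i , w) → Pool (i′ , w′) → i′ <ᶠ i →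
                        ¬ Touches (Y i′) w → Independent (i , w) (i′ , w′)
    independent-below ((_ , v~w , _) , c) ((w′∈H , v~w′ , _) , c′) i′<i w-far =
        Finₚ.<⇒≢ i′<i ∘ sym
      , same-colour⇒non-adjacent v~w v~w′ (trans c (sym c′))
      , w-far
      , λ (p , j , w′~y) → noEdge _ _ i′<i _ _ w′∈H (p , j , refl) w′~y

    -- The witness of largest index is tame on every earlier core, so it touches fewer than 2δ of them,
    -- and it is independent of each witness whose core it does not touch.
    peel : ∀ {Q m} → Q ⊆ Pool → Clique DistinctIndex Q (d + m) →
           ∃[ a ] (Q a × Clique DistinctIndex (λ b → Q b × Independent a b) m)
    peel {Q} {m} Q⊆Pool K with maximal (toℕ ∘ proj₁) K
    ... | a@(i , w) , Qa , K′ with split (λ (i′ , _) → i′ ≟ᶠ i) {1} K′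
    ...   | inj₁ twins = ⊥-elim (no-pair (λ (_ , i′≡i) (_ , i″≡i) i′≢i″ → i′≢i″ (trans i′≡i (sym i″≡i))) twins)
    ...   | inj₂ others with split (λ (i′ , _) → touches? (Y i′) w) {δ′ + δ} {m} others
    ...     | inj₁ touching = ⊥-elim (hub-refuted T-free (s≤s z≤n) 2≤β η+δ≤ζ w (image proj₁ id
              (λ (((_ , i′≤i) , i′≢i) , touches) → hub-below (Q⊆Pool Qa) (Finₚ.≤∧≢⇒< i′≤i i′≢i) touches)
              touching))
    ...     | inj₂ rest = a , Qa , weaken
              (λ (((Qb , i′≤i) , i′≢i) , w-far) →
                 Qb , independent-below (Q⊆Pool Qa) (Q⊆Pool Qb) (Finₚ.≤∧≢⇒< i′≤i i′≢i) w-far)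
              rest

  no-attached-clique : ¬ Clique DistinctIndex Attached (γ δ τ)
  no-attached-clique K =
    let c₀ , class = pigeonhole (colour ∘ proj₂) (λ _ → toℕ<n _)
                       (remote (away-from-home (shrink (γ-fits δ′ τ) K)))
    in remote-refuted T-free (s≤s z≤n) 2≤β δ≤η α+δ≤ζ v
         (weaken proj₁ (greedy d (peel c₀) d id (shrink (n≤1+n _) class)))

mainTheorem10 :
    (τ α δ β : ℕ) (θ : ℕ → ℕ) →
    1 ≤ α → 1 ≤ δ → 2 ≤ β → (∀ m m' → m ≤ m' → θ m ≤ θ m') →
    (G : Graph) → Conditions τ α δ β θ G →
    (ζ η : ℕ) → δ ≤ η → (η ⊔ α) + δ ≤ ζ →
    (T : Templates.TemplateArray G α ζ η β) →
    Templates.TemplateArray.OneCleaned T →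
    ∀ v → Templates.TemplateArray.VT T v →
    ¬ (Σ (Fin (γ δ τ) → Fin (Templates.TemplateArray.n T)) λ f →
         Injective _≡_ _≡_ f ×
         (∀ k → ∃[ w ] (Templates.TemplateArray.H T (f k) w × _∼_ G v w)))
mainTheorem10 τ α δ β θ _ (s≤s z≤n) 2≤β _ G C ζ η δ≤η η⊔α+δ≤ζ T cleaned v v∈T (f , f-inj , nbr) =
  no-attached-clique T cleaned (Conditions.c-i C) (Conditions.c-ii C) 2≤β δ≤η η+δ≤ζ α+δ≤ζ v v∈T
    (tabulate-clique (λ k → f k , proj₁ (nbr k)) (_∘ f-inj) (proj₂ ∘ nbr))
  where
  η+δ≤ζ : η + δ ≤ ζ
  η+δ≤ζ = ≤-trans (+-monoˡ-≤ δ (m≤m⊔n η α)) η⊔α+δ≤ζ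
  α+δ≤ζ : α + δ ≤ ζ
  α+δ≤ζ = ≤-trans (+-monoˡ-≤ δ (m≤n⊔m η α)) η⊔α+δ≤ζ
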